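{- Let $\mathfrak a\subseteq S=k[x_1,\dots,x_n]$ be a monomial ideal and let $\mathcal M=\bigcup_{i\ge1}\mathcal M_i$ be a standard matching on the Taylor resolution of $\mathfrak a$ which ends after the second sequence, i.e. $\mathcal M=\mathcal M_1\cup\mathcal M_2$. Then \[\sum_{I\notin\mathcal M_1}(-1)^{cl(I)}m_I\,t^{cl(I)+|I|}=\sum_{I\notin\mathcal M}(-1)^{cl(I)}m_I\,t^{cl(I)+|I|},\] where both sums run over nonempty subsets $I\subseteq\mathrm{MinGen}(\mathfrak a)$.
   Context: $k$ is a field, $S=k[x_1,\dots,x_n]$, $\mathrm{MinGen}(\mathfrak a)=\{m_1,\dots,m_l\}$ is the minimal monomial generating set of $\mathfrak a$. For $I\subseteq\mathrm{MinGen}(\mathfrak a)$, $m_I=\mathrm{lcm}(m:m\in I)$; $cl(I)$ is the number of equivalence classes of $I$ under the transitive closure of the relation $m\sim m'\iff\gcd(m,m')\neq1$. Algebraic discrete Morse theory: for a complex of free modules with basis $X$ and $\partial c=\sum_{c'}[c:c']c'$, consider the directed graph on $X$ with an edge $c\to c'$ whenever $[c:c']\ne0$. An acyclic matching is a set $\mathcal M$ of edges such that every vertex lies in at most one edge of $\mathcal M$, each $[c:c']$ with $c\to c'\in\mathcal M$ is a central unit, and reversing the edges of $\mathcal M$ yields a graph without directed cycles. The Morse complex is free on the unmatched (critical) basis elements, with differential $\partial^{\mathcal M}(c)=\sum_{c'}\Gamma(c,c')c'$, $\Gamma(c,c')$ being the sum over directed paths from $c$ to $c'$ in the modified graph of the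 products of weights ($[c:c']$ for unreversed edges, $-1/[c:c']$ for reversed ones); it is homotopy equivalent to the original complex. The Taylor resolution $T_\bullet$ of $\mathfrak a$ has $S$-basis indexed by nonempty $I\subseteq\mathrm{MinGen}(\mathfrak a)$ (homological degree $|I|-1$, multidegree $m_I$), with $\partial(I)=\sum_{j=1}^r(-1)^{j+1}\frac{m_I}{m_{I\setminus\{m_{i_j}\}}}(I\setminus\{m_{i_j}\})$ for $I=\{m_{i_1},\dots,m_{i_r}\}$, $i_1<\dots<i_r$. Edges are written $I\to J$ with $|I|=|J|+1$. A standard matching is $\mathcal M=\bigcup_{i\ge1}\mathcal M_i$, where $\mathcal M_i$ is a (sequence of) acyclic matching(s) on the Morse complex $T^{\mathcal M_{<i}}_\bullet$ obtained from $T_\bullet$ via $\mathcal M_{<i}=\bigcup_{j<i}\mathcal M_j$, such that: (1) every edge $I\to J$ of $\mathcal M$ has $m_I=m_J$; (2) every edge $I\to J$ of the final Morse complex $T^{\mathcal M}_\bullet$ has $m_I\ne m_J$; (3) every $I\to J\in\mathcal M_i$ has $|J|+1=|I|$ and $cl(J)-cl(I)=i-1$; (4) there is $\mathcal B_i\subseteq\mathcal M_i$ with $\mathcal M_i=\mathcal B_i\cup\{I\cup K\to J\cup K: I\to J\in\mathcal B_i,\ \gcd(m_I,m_K)=1\}$ and $cl(I)=1$, $cl(J)=i$ for every $I\to J\in\mathcal B_i$. One writes $I\in\mathcal M$ (resp. $I\in\mathcal M_1$) if $I$ lies in some edge of $\mathcal M$ (resp. $\mathcal M_1$). -}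

module Defs where

open import Level using (Level; _⊔_) renaming (suc to lsuc)
open import Data.Bool using (Bool; true; false; _∧_; _∨_; not; if_then_else_)
open import Data.Nat using (ℕ; zero; suc; _+_; _≤_; _<ᵇ_; _≡ᵇ_)
import Data.Nat as ℕ
open import Data.Fin using (Fin; toℕ)
import Data.Fin as Fin
open import Data.Fin.Subset using (Subset; ∣_∣; _∪_)
open import Data.Vec using (Vec; []; _∷_; lookup; zipWith; replicate)
open import Data.Vec.Properties using (≡-dec)
import Data.Bool as Bool
open import Data.List using (List; []; _∷_; _++_; map; concatMap; allFin; filterᵇ; foldr; foldl; length)
open import Data.List.Membership.Propositional using () renaming (_∈_ to _∈ˡ_)
open import Data.List.Relation.Unary.Unique.Propositional using (Unique)
open import Data.Bool.ListAction using (any)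
open import Data.Maybe using (Maybe; just; nothing)
open import Data.Product using (Σ; _×_; _,_)
open import Data.Sum using (_⊎_)
open import Data.Unit using (⊤)
open import Relation.Nullary using (¬_; does)
open import Relation.Binary.PropositionalEquality using (_≡_; _≢_)
open import Algebra.Bundles using (CommutativeRing)

record Field (c ℓ : Level) : Set (lsuc (c ⊔ ℓ)) where
  field
    commutativeRing : CommutativeRing c ℓ
  open CommutativeRing commutativeRing public
  field
    1≉0 : ¬ (1# ≈ 0#)
    inverse : ∀ x → ¬ (x ≈ 0#) → Σ Carrier (λ y → y * x ≈ 1#)

-- Monomials of S = k[x_1..x_n] are represented by exponent vectors.

Monomial : ℕ → Set
Monomial n = Vec ℕ n

one : ∀ {n} → Monomial n
one = replicate _ 0

_∣ᵐ_ : ∀ {n} → Monomial n → Monomial n → Set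
m ∣ᵐ m' = ∀ k → lookup m k ≤ lookup m' k

gcdᵐ lcmᵐ : ∀ {n} → Monomial n → Monomial n → Monomial n
gcdᵐ = zipWith ℕ._⊓_
lcmᵐ = zipWith ℕ._⊔_

_≟ᵐ_ : ∀ {n} (m m' : Monomial n) → Relation.Nullary.Dec (m ≡ m')
_≟ᵐ_ = ≡-dec ℕ._≟_

-- MinGen(a) = {m_1..m_l} : a family of monomials none of which divides
-- another (exactly the minimal monomial generating sets of monomial ideals).
IsMinGen : ∀ {n l} → (Fin l → Monomial n) → Set
IsMinGen {l = l} gens = ∀ (i j : Fin l) → i ≢ j → ¬ (gens i ∣ᵐ gens j)

-- Subsets of MinGen(a) = {m_1..m_l} are subsets of Fin l.

_≟ˢ_ : ∀ {l} (I J : Subset l) → Relation.Nullary.Dec (I ≡ J)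
_≟ˢ_ = ≡-dec Bool._≟_

_∈ᵇ_ : ∀ {l} → Fin l → Subset l → Bool
i ∈ᵇ I = lookup I i

allSubsets : ∀ l → List (Subset l)
allSubsets zero = [] ∷ []
allSubsets (suc l) = map (true ∷_) (allSubsets l) ++ map (false ∷_) (allSubsets l)

nonempty : ∀ {l} → Subset l → Bool
nonempty {l} I = any (_∈ᵇ I) (allFin l)

nonemptySubsets : ∀ l → List (Subset l)
nonemptySubsets l = filterᵇ nonempty (allSubsets l)

module Ideal {n l : ℕ} (gens : Fin l → Monomial n) where

  -- m_I = lcm(m : m ∈ I)  (for I = ∅ this is 1)
  mI : Subset l → Monomial n
  mI I = foldr (λ i acc → if i ∈ᵇ I then lcmᵐ (gens i) acc else acc) one (allFin l)

  rel : Fin l → Fin l → Bool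
  rel i j = not (does (gcdᵐ (gens i) (gens j) ≟ᵐ one))

  reach : Subset l → ℕ → Fin l → Fin l → Bool
  reach I zero i j = does (i Fin.≟ j)
  reach I (suc k) i j =
    does (i Fin.≟ j) ∨ any (λ h → (h ∈ᵇ I) ∧ (rel i h ∧ reach I k h j)) (allFin l)

  -- cl(I): number of equivalence classes of I under the transitive closure
  -- of ∼ ; counted by counting, in each class, its element of least index.
  cl : Subset l → ℕ
  cl I = length (filterᵇ isRep (allFin l))
    where
    isRep : Fin l → Bool
    isRep i = (i ∈ᵇ I) ∧ not (any (λ j → (j ∈ᵇ I) ∧ ((toℕ j <ᵇ toℕ i) ∧ reach I l i j)) (allFin l))

-- All complexes below are multigraded with the basis element I in
-- multidegree m_I, so a coefficient [I:J] ∈ S is  λ · m_I / m_J  with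
-- λ ∈ k; we record only the scalar λ.

data RemSt : Set where
  same : RemSt          -- I and J agree
  once : RemSt          -- J = I minus exactly one element
  bad  : RemSt

step : Bool → Bool → RemSt → RemSt
step true  false same = once
step true  false _    = bad
step false true  _    = bad
step _     _     r    = r

remSt : ∀ {l} → Subset l → Subset l → RemSt
remSt [] [] = same
remSt (a ∷ I) (b ∷ J) = step a b (remSt I J)

module Scalars {c ℓ} (F : Field c ℓ) where
  open Field F using (Carrier; _≈_; 0#; 1#; -_) renaming (_+_ to _+ᵏ_; _*_ to _*ᵏ_)

  sgn : ℕ → Carrier
  sgn zero = 1#
  sgn (suc k) = - sgn k

  sumL : ∀ {A : Set} → List A → (A → Carrier) → Carrier
  sumL xs f = foldr (λ x acc → f x +ᵏ acc) 0# xs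

module Taylor {c ℓ} (F : Field c ℓ) {l : ℕ} where
  open Field F using (Carrier; _≈_; 0#; 1#; -_) renaming (_+_ to _+ᵏ_; _*_ to _*ᵏ_)
  open Scalars F

  countBefore : Subset l → Fin l → ℕ
  countBefore I i = length (filterᵇ (λ j → (j ∈ᵇ I) ∧ (toℕ j <ᵇ toℕ i)) (allFin l))

  removed : Subset l → Subset l → Maybe (Fin l)
  removed I J = go (allFin l)
    where
    go : List (Fin l) → Maybe (Fin l)
    go [] = nothing
    go (i ∷ is) with i ∈ᵇ I | i ∈ᵇ J
    ... | true | false = just i
    ... | _ | _ = go is

  -- scalar part of the Taylor coefficient [I : J]:
  -- (-1)^(j+1) if J = I ∖ {m_{i_j}} (j-th element in increasing order), else 0
  taylorCoef : Subset l → Subset l → Carrier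
  taylorCoef I J with remSt I J | removed I J
  ... | once | just i = sgn (countBefore I i)
  ... | _ | _ = 0#

module Morse {c ℓ} (F : Field c ℓ) {n l : ℕ} (gens : Fin l → Monomial n) where
  open Field F using (Carrier; _≈_; 0#; 1#; -_) renaming (_+_ to _+ᵏ_; _*_ to _*ᵏ_)
  open Scalars F
  open Ideal gens

  record Cx : Set c where
    field
      cells : List (Subset l)
      d     : Subset l → Subset l → Carrier
  open Cx public

  -- a matching: list of edges I → J together with the inverse μ of [I:J]
  Edge : Set c
  Edge = Subset l × Subset l × Carrier

  Matching : Set c
  Matching = List Edge

  src tgt : Edge → Subset l
  src (I , J , μ) = I
  tgt (I , J , μ) = J

  pairOf : Edge → Subset l × Subset l
  pairOf (I , J , μ) = I , J

  endpoints : Matching → List (Subset l)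
  endpoints = concatMap (λ e → src e ∷ tgt e ∷ [])

  isMatched : Matching → Subset l → Bool
  isMatched M v = any (λ e → does (src e ≟ˢ v) ∨ does (tgt e ≟ˢ v)) M

  isEdgeOf : Matching → Subset l → Subset l → Bool
  isEdgeOf M u v = any (λ e → does (src e ≟ˢ u) ∧ does (tgt e ≟ˢ v)) M

  findInv : Matching → Subset l → Subset l → Maybe Carrier
  findInv [] u v = nothing
  findInv ((I , J , μ) ∷ M) u v with does (I ≟ˢ u) ∧ does (J ≟ˢ v)
  ... | true = just μ
  ... | false = findInv M u v

  -- weight of u → v in the graph G_M with the edges of M reversed:
  -- reversed matched edge (v → u ∈ M): -1/[v:u];  matched edge u → v: removed;
  -- otherwise [u:v]
  wt : Cx → Matching → Subset l → Subset l → Carrier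
  wt C M u v with findInv M v u
  ... | just μ = - μ
  ... | nothing = if isEdgeOf M u v then 0# else d C u v

  data Path (C : Cx) (M : Matching) : Subset l → Subset l → Set (c ⊔ ℓ) where
    edge : ∀ {u v} → u ∈ˡ cells C → v ∈ˡ cells C → ¬ (wt C M u v ≈ 0#) → Path C M u v
    _∷ᵖ_ : ∀ {u v w} → (u ∈ˡ cells C × ¬ (wt C M u v ≈ 0#)) → Path C M v w → Path C M u w

  IsAcyclicMatching : Cx → Matching → Set (c ⊔ ℓ)
  IsAcyclicMatching C M =
      (∀ {e} → e ∈ˡ M →
         src e ∈ˡ cells C × tgt e ∈ˡ cells C
         -- [I:J] = λ · m_I/m_J is a (central) unit of S: λ invertible, m_I = m_J
         × (Data.Product.proj₂ (Data.Product.proj₂ e) *ᵏ d C (src e) (tgt e) ≈ 1#)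
         × mI (src e) ≡ mI (tgt e))
    × Unique (endpoints M)
    × (∀ v → ¬ Path C M v v)

  -- sum of weights of all walks u → v of length k+1 in G_M (walks through
  -- non-edges have weight 0, so this is the sum over paths of length k+1)
  walk : Cx → Matching → ℕ → Subset l → Subset l → Carrier
  walk C M zero u v = wt C M u v
  walk C M (suc k) u v = sumL (cells C) (λ x → wt C M u x *ᵏ walk C M k x v)

  -- Γ(u,v): sum over all paths u → v (in an acyclic G_M on N vertices all
  -- paths have length ≤ N)
  Γ : Cx → Matching → Subset l → Subset l → Carrier
  Γ C M u v = sumL (Data.List.upTo (length (cells C))) (λ k → walk C M k u v)

  -- the Morse complex C^M (differential from degree |I|-1 to |I|-2 only)
  morse : Cx → Matching → Cx
  morse C M = record
    { cells = filterᵇ (λ v → not (isMatched M v)) (cells C)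
    ; d = λ u v → if (∣ v ∣ + 1) ≡ᵇ ∣ u ∣ then Γ C M u v else 0#
    }

  AcycSeq : Cx → List Matching → Set (c ⊔ ℓ)
  AcycSeq C [] = Lift⊤
    where open import Data.Unit.Polymorphic using () renaming (⊤ to Lift⊤)
  AcycSeq C (M ∷ Ms) = IsAcyclicMatching C M × AcycSeq (morse C M) Ms

  morseSeq : Cx → List Matching → Cx
  morseSeq = foldl morse

  taylor : Cx
  taylor = record { cells = nonemptySubsets l ; d = Taylor.taylorCoef F }

  edgesOf : List Matching → List (Subset l × Subset l)
  edgesOf Ms = map pairOf (Data.List.concat Ms)

  verticesOf : List Matching → List (Subset l)
  verticesOf Ms = endpoints (Data.List.concat Ms)

  Cond3 : ℕ → List Matching → Set
  Cond3 i Ms = ∀ {I J} → (I , J) ∈ˡ edgesOf Ms →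
    (∣ J ∣ + 1 ≡ ∣ I ∣) × (cl J ≡ cl I + (i ℕ.∸ 1))

  Cond4 : ℕ → List Matching → Set
  Cond4 i Ms = Σ (List (Subset l × Subset l)) λ B →
      (∀ {p} → p ∈ˡ B → p ∈ˡ edgesOf Ms)
    × (∀ {I J} → (I , J) ∈ˡ B → cl I ≡ 1 × cl J ≡ i)
    × (∀ {I J} (K : Subset l) → (I , J) ∈ˡ B → gcdᵐ (mI I) (mI K) ≡ one →
         (I ∪ K , J ∪ K) ∈ˡ edgesOf Ms)
    × (∀ {p} → p ∈ˡ edgesOf Ms →
         p ∈ˡ B ⊎ Σ (Subset l) λ I → Σ (Subset l) λ J → Σ (Subset l) λ K →
           (I , J) ∈ˡ B × gcdᵐ (mI I) (mI K) ≡ one × p ≡ (I ∪ K , J ∪ K))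

  -- M = M_1 ∪ M_2 is a standard matching on the Taylor resolution
  -- (M_i = ∅ for i ≥ 3); Ms₁, Ms₂ are the sequences of acyclic matchings
  -- making up M_1 and M_2.
  IsStandard₂ : List Matching → List Matching → Set (c ⊔ ℓ)
  IsStandard₂ Ms₁ Ms₂ =
      AcycSeq taylor (Ms₁ ++ Ms₂)
    × (∀ {I J} → (I , J) ∈ˡ edgesOf (Ms₁ ++ Ms₂) → mI I ≡ mI J)
    × (let T = morseSeq taylor (Ms₁ ++ Ms₂) in
       ∀ {I J} → I ∈ˡ cells T → J ∈ˡ cells T → ¬ (d T I J ≈ 0#) → mI I ≢ mI J)
    × Cond3 1 Ms₁ × Cond3 2 Ms₂
    × Cond4 1 Ms₁ × Cond4 2 Ms₂

  memb : List (Subset l) → Subset l → Bool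
  memb xs v = any (λ w → does (w ≟ˢ v)) xs

  -- coefficient of  x^μ t^e  in  Σ_{I ∉ V} (-1)^{cl(I)} m_I t^{cl(I)+|I|}
  -- (I ranging over nonempty subsets of MinGen(a))
  coeffNotIn : List (Subset l) → Monomial n → ℕ → Carrier
  coeffNotIn V μ e = sumL (nonemptySubsets l) λ I →
    if not (memb V I) ∧ (does (mI I ≟ᵐ μ) ∧ (cl I + ∣ I ∣ ≡ᵇ e))
    then sgn (cl I) else 0#

{-# OPTIONS --safe #-}
-- Each acyclic matching lives on the critical cells left by the previous ones,
-- so M₁ and M₂ have disjoint vertex sets and the two sums differ exactly by the
-- summands indexed by vertices of M₂. These cancel in pairs along the edges of
-- M₂: an edge I → J has m_I = m_J, |J| = |I| - 1 and cl(J) = cl(I) + 1, so its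
-- ends contribute the same monomial m_I t^{cl(I)+|I|} with opposite signs.
module Submission where

open import Defs
open import Data.Nat using (ℕ)
open import Data.Fin using (Fin)
open import Data.List using (List; []; _∷_; _++_; map; concat; foldr)
open import Level using (Level)
open import Algebra.Bundles using (CommutativeMonoid)
open import Data.Bool using (Bool; true; false; _∧_; _∨_; not; if_then_else_; T)
open import Data.Bool.ListAction using (any)
open import Data.Bool.Properties using (∨-assoc; T-not-≡)
open import Data.Empty using (⊥-elim)
open import Data.Unit using (tt)
open import Data.Fin.Subset using (Subset; ∣_∣)
open import Data.List.Properties using (concat-++; concatMap-++; map-++)
open import Data.List.Membership.Propositional using (_∈_; _∉_; find)
open import Data.List.Membership.Propositional.Properties
  using (∈-++⁺ʳ; ∈-++⁻; ∈-map⁺; ∈-map⁻; ∈-filter⁻; ∈-concatMap⁻)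
open import Data.List.Relation.Binary.Disjoint.Propositional using (Disjoint)
open import Data.List.Relation.Binary.Subset.Propositional using (_⊆_)
open import Data.List.Relation.Unary.All as All using ([])
open import Data.List.Relation.Unary.AllPairs using ([]; _∷_)
open import Data.List.Relation.Unary.Any using (here; there)
open import Data.List.Relation.Unary.Unique.Propositional using (Unique)
open import Data.List.Relation.Unary.Unique.Propositional.Properties
  using (++⁺; map⁺; filter⁺)
import Data.Nat as ℕ
import Data.Nat.Properties as ℕₚ
open import Data.Product using (_×_; _,_; proj₁; proj₂)
open import Data.Sum using (inj₁; inj₂)
open import Data.Vec using (_∷_)
open import Data.Vec.Properties using (∷-injectiveʳ)
open import Function using (_∘_; Equivalence)
open import Relation.Binary.Definitions using (DecidableEquality)
open import Relation.Binary.PropositionalEquality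
  using (_≡_; refl; sym; trans; cong; cong₂; subst)
open import Relation.Nullary using (yes; no; does; ¬_)
open import Relation.Nullary.Decidable using (T?)

private
  variable
    a : Level
    A : Set a

Unique-++⁻ : ∀ (xs : List A) {ys} → Unique (xs ++ ys) → Unique ys × Disjoint xs ys
Unique-++⁻ []       u        = u , λ ()
Unique-++⁻ (x ∷ xs) (x∉ ∷ u) with Unique-++⁻ xs u
... | ys-unique , xs#ys = ys-unique , λ
  { (here refl , v∈ys) → All.lookup x∉ (∈-++⁺ʳ xs v∈ys) refl
  ; (there v∈xs , v∈ys) → xs#ys (v∈xs , v∈ys) }

module BoolMembership (_≟_ : DecidableEquality A) where

  mem : List A → A → Bool
  mem ys x = any (λ y → does (y ≟ x)) ys

  mem⇒∈ : ∀ ys {x} → T (mem ys x) → x ∈ ys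
  mem⇒∈ []       ()
  mem⇒∈ (y ∷ ys) {x} x∈? with y ≟ x
  ... | yes refl = here refl
  ... | no _     = there (mem⇒∈ ys x∈?)

  mem-++ : ∀ ys zs x → mem (ys ++ zs) x ≡ mem ys x ∨ mem zs x
  mem-++ []       zs x = refl
  mem-++ (y ∷ ys) zs x =
    trans (cong (does (y ≟ x) ∨_) (mem-++ ys zs x)) (sym (∨-assoc (does (y ≟ x)) _ _))

module ListSum {c ℓ} (M : CommutativeMonoid c ℓ) where
  open CommutativeMonoid M renaming (refl to ≈-refl; sym to ≈-sym; trans to ≈-trans)
  open import Algebra.Properties.CommutativeSemigroup commutativeSemigroup using (interchange)
  open import Relation.Binary.Reasoning.Setoid setoid

  ∑ : List A → (A → Carrier) → Carrier
  ∑ xs f = foldr (λ x acc → f x ∙ acc) ε xs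

  ∑-cong : ∀ xs {f g : A → Carrier} → (∀ x → f x ≈ g x) → ∑ xs f ≈ ∑ xs g
  ∑-cong []       f≈g = ≈-refl
  ∑-cong (x ∷ xs) f≈g = ∙-cong (f≈g x) (∑-cong xs f≈g)

  ∑-zero : ∀ xs {f : A → Carrier} → (∀ {x} → x ∈ xs → f x ≈ ε) → ∑ xs f ≈ ε
  ∑-zero []       f≈ε = ≈-refl
  ∑-zero (x ∷ xs) f≈ε = ≈-trans (∙-cong (f≈ε (here refl)) (∑-zero xs (f≈ε ∘ there))) (identityˡ ε)

  ∑-distrib : ∀ xs (f g : A → Carrier) → ∑ xs (λ x → f x ∙ g x) ≈ ∑ xs f ∙ ∑ xs g
  ∑-distrib []       f g = ≈-sym (identityˡ ε)
  ∑-distrib (x ∷ xs) f g =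
    ≈-trans (∙-congˡ (∑-distrib xs f g)) (interchange (f x) (g x) (∑ xs f) (∑ xs g))

  module Restriction (_≟_ : DecidableEquality A) where
    open BoolMembership _≟_

    inside outside : List A → (A → Carrier) → A → Carrier
    inside  ys f x = if mem ys x then f x else ε
    outside ys f x = if mem ys x then ε else f x

    ∑-delta : ∀ xs {y} (f : A → Carrier) → Unique xs → y ∈ xs →
              ∑ xs (λ x → if does (y ≟ x) then f x else ε) ≈ f y
    ∑-delta (x ∷ xs) {y} f (x∉xs ∷ xs-unique) y∈ with y ≟ x | y∈
    ... | yes refl | _ = ≈-trans (∙-congˡ (∑-zero xs others≈ε)) (identityʳ (f y))
      where
      others≈ε : ∀ {z} → z ∈ xs → (if does (y ≟ z) then f z else ε) ≈ ε
      others≈ε {z} z∈xs with y ≟ z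
      ... | yes refl = ⊥-elim (All.lookup x∉xs z∈xs refl)
      ... | no _     = ≈-refl
    ... | no y≢x | here y≡x  = ⊥-elim (y≢x y≡x)
    ... | no _   | there y∈xs = ≈-trans (identityˡ _) (∑-delta xs f xs-unique y∈xs)

    ∑-inside : ∀ xs ys (f : A → Carrier) → Unique xs → Unique ys → ys ⊆ xs →
               ∑ xs (inside ys f) ≈ ∑ ys f
    ∑-inside xs []       f xs-unique _ _ = ∑-zero xs (λ _ → ≈-refl)
    ∑-inside xs (y ∷ ys) f xs-unique (y∉ys ∷ ys-unique) ys⊆xs = begin
      ∑ xs (inside (y ∷ ys) f)                                       ≈⟨ ∑-cong xs split ⟩
      ∑ xs (λ x → (if does (y ≟ x) then f x else ε) ∙ inside ys f x) ≈⟨ ∑-distrib xs _ _ ⟩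
      ∑ xs (λ x → if does (y ≟ x) then f x else ε) ∙ ∑ xs (inside ys f)
        ≈⟨ ∙-cong (∑-delta xs f xs-unique (ys⊆xs (here refl)))
                  (∑-inside xs ys f xs-unique ys-unique (ys⊆xs ∘ there)) ⟩
      f y ∙ ∑ ys f                                                   ∎
      where
      split : ∀ x → inside (y ∷ ys) f x ≈ (if does (y ≟ x) then f x else ε) ∙ inside ys f x
      split x with y ≟ x
      ... | no _ = ≈-sym (identityˡ _)
      ... | yes refl with mem ys y in y∈?
      ...   | true  = ⊥-elim (All.lookup y∉ys (mem⇒∈ ys (subst T (sym y∈?) _)) refl)
      ...   | false = ≈-sym (identityʳ (f y))

    outside-++ : ∀ ys zs (f : A → Carrier) x → (T (mem ys x) → ¬ T (mem zs x)) →
                 outside ys f x ≈ outside (ys ++ zs) f x ∙ inside zs f x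
    outside-++ ys zs f x ys#zs rewrite mem-++ ys zs x with mem ys x | mem zs x | ys#zs
    ... | true  | true  | ys#zs = ⊥-elim (ys#zs _ _)
    ... | true  | false | _     = ≈-sym (identityˡ ε)
    ... | false | true  | _     = ≈-sym (identityˡ (f x))
    ... | false | false | _     = ≈-sym (identityʳ (f x))

    ∑-outside-++ : ∀ xs ys zs (f : A → Carrier) → Unique xs → Unique (ys ++ zs) → zs ⊆ xs →
                   ∑ xs (outside ys f) ≈ ∑ xs (outside (ys ++ zs) f) ∙ ∑ zs f
    ∑-outside-++ xs ys zs f xs-unique ys++zs-unique zs⊆xs = begin
      ∑ xs (outside ys f)                                        ≈⟨ ∑-cong xs split ⟩
      ∑ xs (λ x → outside (ys ++ zs) f x ∙ inside zs f x)        ≈⟨ ∑-distrib xs _ _ ⟩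
      ∑ xs (outside (ys ++ zs) f) ∙ ∑ xs (inside zs f)
        ≈⟨ ∙-congˡ (∑-inside xs zs f xs-unique zs-unique zs⊆xs) ⟩
      ∑ xs (outside (ys ++ zs) f) ∙ ∑ zs f                       ∎
      where
      zs-unique = proj₁ (Unique-++⁻ ys ys++zs-unique)
      split : ∀ x → outside ys f x ≈ outside (ys ++ zs) f x ∙ inside zs f x
      split x = outside-++ ys zs f x λ x∈ys x∈zs →
        proj₂ (Unique-++⁻ ys ys++zs-unique) (mem⇒∈ ys x∈ys , mem⇒∈ zs x∈zs)

allSubsets-unique : ∀ l → Unique (allSubsets l)
allSubsets-unique ℕ.zero    = [] ∷ []
allSubsets-unique (ℕ.suc l) =
  ++⁺ (map⁺ ∷-injectiveʳ (allSubsets-unique l)) (map⁺ ∷-injectiveʳ (allSubsets-unique l)) heads-differ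
  where
  heads-differ : Disjoint (map (true ∷_) (allSubsets l)) (map (false ∷_) (allSubsets l))
  heads-differ (p , q) with ∈-map⁻ (true ∷_) p | ∈-map⁻ (false ∷_) q
  ... | _ , _ , refl | _ , _ , ()

nonemptySubsets-unique : ∀ l → Unique (nonemptySubsets l)
nonemptySubsets-unique l = filter⁺ (T? ∘ nonempty) (allSubsets-unique l)

module TaylorSums {c ℓ} (F : Field c ℓ) {n l : ℕ} (gens : Fin l → Monomial n) where
  open Field F renaming (refl to ≈-refl; sym to ≈-sym; trans to ≈-trans)
  open Scalars F
  open Ideal gens
  open Morse F gens
  open ListSum +-commutativeMonoid public
  open Restriction (_≟ˢ_ {l}) public
  open import Relation.Binary.Reasoning.Setoid setoid

  endpoints-++ : ∀ (E E′ : Matching) → endpoints (E ++ E′) ≡ endpoints E ++ endpoints E′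
  endpoints-++ = concatMap-++ (λ e → src e ∷ tgt e ∷ [])

  verticesOf-++ : ∀ Ms Ms′ → verticesOf (Ms ++ Ms′) ≡ verticesOf Ms ++ verticesOf Ms′
  verticesOf-++ Ms Ms′ =
    trans (cong endpoints (sym (concat-++ Ms Ms′))) (endpoints-++ (concat Ms) (concat Ms′))

  edgesOf-++ : ∀ Ms Ms′ → edgesOf (Ms ++ Ms′) ≡ edgesOf Ms ++ edgesOf Ms′
  edgesOf-++ Ms Ms′ =
    trans (cong (map pairOf) (sym (concat-++ Ms Ms′))) (map-++ pairOf (concat Ms) (concat Ms′))

  endpoints⊆ : ∀ {E : Matching} {X} → (∀ {e} → e ∈ E → src e ∈ X × tgt e ∈ X) → endpoints E ⊆ X
  endpoints⊆ ends∈X v∈ with find (∈-concatMap⁻ (λ e → src e ∷ tgt e ∷ []) v∈)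
  ... | _ , e∈E , here refl         = proj₁ (ends∈X e∈E)
  ... | _ , e∈E , there (here refl) = proj₂ (ends∈X e∈E)

  ∈endpoints⇒isMatched : ∀ (M : Matching) {v} → v ∈ endpoints M → T (isMatched M v)
  ∈endpoints⇒isMatched [] ()
  ∈endpoints⇒isMatched ((I , J , _) ∷ M) {v} v∈ with I ≟ˢ v | J ≟ˢ v | v∈
  ... | yes _  | _      | _                = tt
  ... | no _   | yes _  | _                = tt
  ... | no I≢v | no _   | here v≡I         = ⊥-elim (I≢v (sym v≡I))
  ... | no _   | no J≢v | there (here v≡J) = ⊥-elim (J≢v (sym v≡J))
  ... | no _   | no _   | there (there v∈M) = ∈endpoints⇒isMatched M v∈M

  ∈morse⁻ : ∀ {C} (M : Matching) {v} → v ∈ cells (morse C M) → v ∈ cells C × v ∉ endpoints M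
  ∈morse⁻ {C} M v∈ with ∈-filter⁻ (T? ∘ (λ u → not (isMatched M u))) {xs = cells C} v∈
  ... | v∈C , unmatched =
    v∈C , λ v∈M → subst T (Equivalence.to T-not-≡ unmatched) (∈endpoints⇒isMatched M v∈M)

  vertices⊆cells : ∀ {C} Ms → AcycSeq C Ms → verticesOf Ms ⊆ cells C
  vertices⊆cells {C} (M ∷ Ms) ((edges∈ , _) , rest) v∈
    with ∈-++⁻ (endpoints M) (subst (_ ∈_) (endpoints-++ M (concat Ms)) v∈)
  ... | inj₁ v∈M  = endpoints⊆ (λ e∈ → proj₁ (edges∈ e∈) , proj₁ (proj₂ (edges∈ e∈))) v∈M
  ... | inj₂ v∈Ms = proj₁ (∈morse⁻ {C} M (vertices⊆cells Ms rest v∈Ms))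

  vertices-unique : ∀ {C} Ms → AcycSeq C Ms → Unique (verticesOf Ms)
  vertices-unique []       _ = []
  vertices-unique {C} (M ∷ Ms) ((_ , endpoints-unique , _) , rest) =
    subst Unique (sym (endpoints-++ M (concat Ms)))
      (++⁺ endpoints-unique (vertices-unique Ms rest)
           λ (v∈M , v∈Ms) → proj₂ (∈morse⁻ {C} M (vertices⊆cells Ms rest v∈Ms)) v∈M)

  term : Monomial n → ℕ → Subset l → Carrier
  term μ e I = if does (mI I ≟ᵐ μ) ∧ (cl I ℕ.+ ∣ I ∣ ℕ.≡ᵇ e) then sgn (cl I) else 0#

  coeffNotIn≈∑-outside : ∀ V μ e → coeffNotIn V μ e ≈ ∑ (nonemptySubsets l) (outside V (term μ e))
  coeffNotIn≈∑-outside V μ e = ∑-cong (nonemptySubsets l) pointwise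
    where
    pointwise : ∀ I → (if not (memb V I) ∧ (does (mI I ≟ᵐ μ) ∧ (cl I ℕ.+ ∣ I ∣ ℕ.≡ᵇ e))
                       then sgn (cl I) else 0#) ≈ outside V (term μ e) I
    pointwise I with memb V I
    ... | true  = ≈-refl
    ... | false = ≈-refl

  if-cancel : ∀ b x → (if b then x else 0#) + (if b then - x else 0#) ≈ 0#
  if-cancel true  x = -‿inverseʳ x
  if-cancel false x = +-identityʳ 0#

  term-cancel : ∀ μ e {I J} → ∣ J ∣ ℕ.+ 1 ≡ ∣ I ∣ → cl J ≡ cl I ℕ.+ 1 → mI I ≡ mI J →
                term μ e I + term μ e J ≈ 0#
  term-cancel μ e {I} {J} |J|+1≡|I| clJ≡clI+1 mI≡mJ = begin
    term μ e I + term μ e J                                           ≡⟨ cong (term μ e I +_) J-as-I ⟩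
    (if b then sgn (cl I) else 0#) + (if b then - sgn (cl I) else 0#) ≈⟨ if-cancel b (sgn (cl I)) ⟩
    0#                                                                ∎
    where
    b = does (mI I ≟ᵐ μ) ∧ (cl I ℕ.+ ∣ I ∣ ℕ.≡ᵇ e)

    same-degree : cl J ℕ.+ ∣ J ∣ ≡ cl I ℕ.+ ∣ I ∣
    same-degree = trans (cong (ℕ._+ ∣ J ∣) clJ≡clI+1)
      (trans (ℕₚ.+-assoc (cl I) 1 ∣ J ∣) (cong (cl I ℕ.+_) (trans (ℕₚ.+-comm 1 ∣ J ∣) |J|+1≡|I|)))

    opposite-sign : sgn (cl J) ≡ - sgn (cl I)
    opposite-sign = cong sgn (trans clJ≡clI+1 (ℕₚ.+-comm (cl I) 1))

    J-as-I : term μ e J ≡ (if b then - sgn (cl I) else 0#)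
    J-as-I = cong₂ (λ b s → if b then s else 0#)
      (cong₂ (λ m w → does (m ≟ᵐ μ) ∧ (w ℕ.≡ᵇ e)) (sym mI≡mJ) same-degree) opposite-sign

  ∑-endpoints≈0 : ∀ (f : Subset l → Carrier) (E : Matching) →
                  (∀ {e} → e ∈ E → f (src e) + f (tgt e) ≈ 0#) → ∑ (endpoints E) f ≈ 0#
  ∑-endpoints≈0 f []      _       = ≈-refl
  ∑-endpoints≈0 f (e ∷ E) cancels = begin
    f (src e) + (f (tgt e) + ∑ (endpoints E) f) ≈⟨ +-assoc (f (src e)) _ _ ⟨
    (f (src e) + f (tgt e)) + ∑ (endpoints E) f
      ≈⟨ +-cong (cancels (here refl)) (∑-endpoints≈0 f E (cancels ∘ there)) ⟩
    0# + 0#                                     ≈⟨ +-identityʳ 0# ⟩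
    0#                                          ∎

  ∑-vertices-term≈0 : ∀ μ e Ms → (∀ {I J} → (I , J) ∈ edgesOf Ms → mI I ≡ mI J) → Cond3 2 Ms →
                      ∑ (verticesOf Ms) (term μ e) ≈ 0#
  ∑-vertices-term≈0 μ e Ms sameMonomial cond3 = ∑-endpoints≈0 (term μ e) (concat Ms) edge-cancels
    where
    edge-cancels : ∀ {ed} → ed ∈ concat Ms → term μ e (src ed) + term μ e (tgt ed) ≈ 0#
    edge-cancels {I , J , _} ed∈ =
      let (sizes , classes) = cond3 (∈-map⁺ pairOf ed∈)
      in  term-cancel μ e {I} {J} sizes classes (sameMonomial (∈-map⁺ pairOf ed∈))

lemma3p3 : ∀ {c ℓ} (k : Field c ℓ) (n l : ℕ) (gens : Fin l → Monomial n) →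
    IsMinGen gens →
    (Ms₁ Ms₂ : List (Morse.Matching k gens)) →
    Morse.IsStandard₂ k gens Ms₁ Ms₂ →
    ∀ (μ : Monomial n) (e : ℕ) →
    Field._≈_ k (Morse.coeffNotIn k gens (Morse.verticesOf k gens Ms₁) μ e)
                (Morse.coeffNotIn k gens (Morse.verticesOf k gens (Ms₁ Data.List.++ Ms₂)) μ e)
lemma3p3 k n l gens _ Ms₁ Ms₂ (acyclic , sameMonomial , _ , _ , cond3₂ , _) μ e = begin
  coeffNotIn V₁ μ e                         ≈⟨ coeffNotIn≈∑-outside V₁ μ e ⟩
  ∑ L (outside V₁ f)
    ≈⟨ ∑-outside-++ L V₁ V₂ f (nonemptySubsets-unique l) V-unique V₂⊆L ⟩
  ∑ L (outside (V₁ ++ V₂) f) + ∑ V₂ f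
    ≈⟨ +-congˡ (∑-vertices-term≈0 μ e Ms₂ M₂-sameMonomial cond3₂) ⟩
  ∑ L (outside (V₁ ++ V₂) f) + 0#           ≈⟨ +-identityʳ _ ⟩
  ∑ L (outside (V₁ ++ V₂) f)                ≈⟨ coeffNotIn≈∑-outside (V₁ ++ V₂) μ e ⟨
  coeffNotIn (V₁ ++ V₂) μ e                 ≡⟨ cong (λ V → coeffNotIn V μ e) (verticesOf-++ Ms₁ Ms₂) ⟨
  coeffNotIn (verticesOf (Ms₁ ++ Ms₂)) μ e  ∎
  where
  open Field k using (_+_; 0#; setoid; +-congˡ; +-identityʳ)
  open Ideal gens using (mI)
  open Morse k gens using (coeffNotIn; verticesOf; edgesOf)
  open TaylorSums k gens
  open import Relation.Binary.Reasoning.Setoid setoid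

  L  = nonemptySubsets l
  V₁ = verticesOf Ms₁
  V₂ = verticesOf Ms₂
  f  = term μ e

  V-unique : Unique (V₁ ++ V₂)
  V-unique = subst Unique (verticesOf-++ Ms₁ Ms₂) (vertices-unique (Ms₁ ++ Ms₂) acyclic)

  V₂⊆L : V₂ ⊆ L
  V₂⊆L = vertices⊆cells (Ms₁ ++ Ms₂) acyclic ∘ subst (_ ∈_) (sym (verticesOf-++ Ms₁ Ms₂)) ∘ ∈-++⁺ʳ V₁

  M₂-sameMonomial : ∀ {I J} → (I , J) ∈ edgesOf Ms₂ → mI I ≡ mI J
  M₂-sameMonomial = sameMonomial ∘ subst (_ ∈_) (sym (edgesOf-++ Ms₁ Ms₂)) ∘ ∈-++⁺ʳ (edgesOf Ms₁)
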